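{- Fix a constant positive integer $k$ and a constant bound $\Delta$ on vertex degrees. Then every rooted directed tree $T$ with $n$ vertices and maximum degree at most $\Delta$ admits a persistent reversible pebbling using $O(n^{1/k})$ pebbles and $O(n)$ pebbling moves, where the implied constants depend only on $k$ and $\Delta$.
   Context: A rooted directed tree is a directed graph whose underlying undirected graph is a tree and which has a vertex $r$ (the root) reachable by a directed path from every vertex. A persistent reversible pebbling of $T$ is a sequence $P_1,\dots,P_m$ of vertex subsets with $P_1=\emptyset$, $P_m=\{r\}$, such that each $P_i$ ($i\ge2$) is obtained from $P_{i-1}$ by adding or removing exactly one vertex $v$ (a pebbling move), all of whose in-neighbours lie in $P_{i-1}$. Its number of pebbles is $\max_i|P_i|$ and its number of moves is $m-1$. -}

module Defs where

open import Data.Nat using (ℕ; zero; suc; _+_; _*_; _^_; _≤_)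
open import Data.Bool using (Bool; true; false; T; not; _∨_; if_then_else_)
open import Data.Fin using (Fin; zero; suc; inject₁; fromℕ)
open import Data.Fin.Subset using (Subset; ⊥; ⁅_⁆; _∈_; _∉_; ∣_∣)
open import Data.Vec using (lookup; _[_]≔_)
open import Data.List using (List; map; allFin)
open import Data.Nat.ListAction using (sum)
open import Data.Empty using () renaming (⊥ to Empty)
open import Data.Sum using (_⊎_)
open import Data.Product using (Σ; _×_; ∃; ∃-syntax)
open import Relation.Binary.PropositionalEquality using (_≡_)
open import Relation.Nullary using (¬_)
open import Function.Definitions using (Injective)

Digraph : ℕ → Set
Digraph n = Fin n → Fin n → Bool

Arc : ∀ {n} → Digraph n → Fin n → Fin n → Set
Arc E u v = T (E u v)

Adj : ∀ {n} → Digraph n → Fin n → Fin n → Set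
Adj E u v = Arc E u v ⊎ Arc E v u

data DReach {n} (E : Digraph n) : Fin n → Fin n → Set where
  here : ∀ {v} → DReach E v v
  step : ∀ {u w v} → Arc E u w → DReach E w v → DReach E u v

data UReach {n} (E : Digraph n) : Fin n → Fin n → Set where
  here : ∀ {v} → UReach E v v
  step : ∀ {u w v} → Adj E u w → UReach E w v → UReach E u v

Cycle : ∀ {n} → Digraph n → Set
Cycle {n} E = ∃[ m ] Σ (Fin (3 + m) → Fin n) λ c →
  Injective _≡_ _≡_ c
  × (∀ (i : Fin (2 + m)) → Adj E (c (inject₁ i)) (c (suc i)))
  × Adj E (c (fromℕ (2 + m))) (c zero)

-- the underlying undirected (multi)graph is a tree: no loops, no pair of
-- antiparallel arcs (which would form a 2-cycle), no longer cycles, connected.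
UnderlyingTree : ∀ {n} → Digraph n → Set
UnderlyingTree {n} E =
  (∀ v → ¬ Arc E v v)
  × (∀ u v → Arc E u v → ¬ Arc E v u)
  × ¬ Cycle E
  × (∀ u v → UReach E u v)

RootedTree : ∀ {n} → Digraph n → Fin n → Set
RootedTree E r = UnderlyingTree E × (∀ v → DReach E v r)

degree : ∀ {n} → Digraph n → Fin n → ℕ
degree {n} E v = sum (map (λ u → if E u v ∨ E v u then 1 else 0) (allFin n))

Move : ∀ {n} → Digraph n → Subset n → Subset n → Set
Move {n} E P Q = ∃[ v ] (Q ≡ P [ v ]≔ not (lookup P v)) × (∀ u → Arc E u v → u ∈ P)

IsPebbling : ∀ {n} → Digraph n → Fin n → (m : ℕ) → (Fin (suc m) → Subset n) → Set
IsPebbling E r m P =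
  P zero ≡ ⊥
  × P (fromℕ m) ≡ ⁅ r ⁆
  × (∀ (i : Fin m) → Move E (P (inject₁ i)) (P (suc i)))

module Submission where

-- The in-neighbours of the root unfold into a tree with at most n nodes and branching at most
-- D = Δ + 1. A strategy of level i pebbles the root of a tree with at most 2 D B^(i+1) nodes, and
-- nothing else: it cuts the tree bottom-up into at most 2 D B pieces of between B^i and D B^i + 1
-- nodes plus a top remainder, pebbles the roots of the pieces one after another by level i - 1
-- strategies, pebbles the root of the remainder (whose leaves are those roots), and then undoes
-- the first phase by playing it backwards, which is legal because moves are reversible. Each level
-- adds O(D B) pebbles and at most doubles the number of moves, so k levels with B = ⌈n^(1/k)⌉
-- use O(k D n^(1/k)) pebbles and at most 2^k n moves.

open import Defs
open import Data.Bool using (true; false; not; T; if_then_else_; _∨_)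
open import Data.Bool.Properties using (not-involutive)
open import Data.Empty using (⊥) renaming (⊥-elim to absurd)
open import Data.Fin using (Fin; zero; suc; inject₁; fromℕ; _≟_)
open import Data.Fin.Properties using (pigeonhole) renaming (<-irrefl to <-irreflᶠ)
open import Data.Fin.Subset using (Subset; ∣_∣; ⁅_⁆) renaming (⊥ to ∅)
open import Data.Fin.Subset.Properties using (∣⊥∣≡0)
import Data.List as List
open import Data.List using (List; []; _∷_; _++_; length; reverse; map; [_]; concatMap; allFin)
open import Data.List.Properties using (length-reverse; reverse-++; length-++; ++-assoc; length-map)
open import Data.List.Membership.Propositional using (_∈_; _∉_)
open import Data.List.Membership.Propositional.Properties
  using (∈-++⁺ˡ; ∈-++⁺ʳ; ∈-++⁻; ∈-map⁺; ∈-map⁻; ∈-lookup; ∈-allFin)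
open import Data.List.Relation.Binary.Subset.Propositional using (_⊆_)
import Data.List.Relation.Binary.Permutation.Propositional as ↭
open ↭ using (_↭_; ↭-refl; ↭-sym; ↭-trans; ↭-reflexive)
open import Data.List.Relation.Binary.Permutation.Propositional.Properties
  using (∈-resp-↭; ++⁺; ++⁺ˡ; ++⁺ʳ; shifts; ↭-length)
import Data.List.Relation.Unary.All as All
open All using (All; []; _∷_)
import Data.List.Relation.Unary.All.Properties as Allₚ
open import Data.List.Relation.Unary.Any using (here; there)
open import Data.List.Relation.Unary.Unique.Propositional using (Unique; []; _∷_)
open import Data.List.Relation.Unary.Unique.Propositional.Properties using (allFin⁺)
open import Data.Nat using (ℕ; zero; suc; pred; _+_; _*_; _^_; _≤_; _<_; z≤n; s≤s; _≤?_; >-nonZero)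
open import Data.Nat.ListAction using (sum)
open import Data.Nat.Properties hiding (_≟_)
open import Data.Nat.Solver using (module +-*-Solver)
open +-*-Solver using (solve; _:+_; _:*_; _:=_; con)
open import Data.Product using (Σ; _×_; _,_; proj₁; proj₂; map₁; ∃-syntax)
open import Data.Sum using (_⊎_; inj₁; inj₂; [_,_]′)
open import Data.Unit using (⊤; tt)
open import Data.Vec using (_∷_; lookup; _[_]≔_)
open import Data.Vec.Properties
  using (lookup⇒[]=; lookup-replicate; lookup∘update; lookup∘update′; []≔-idempotent; []≔-commutes; []≔-lookup)
open import Function using (_∘_; id)
open import Function.Definitions using (Injective)
open import Relation.Binary.Construct.Closure.ReflexiveTransitive as Star using (Star; ε; _◅_; _◅◅_)
open import Relation.Binary.PropositionalEquality hiding ([_])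
open import Relation.Nullary using (¬_; yes; no)

Distinct : {A : Set} → List A → Set
Distinct [] = ⊤
Distinct (x ∷ xs) = x ∉ xs × Distinct xs

module _ {A : Set} where

  distinct-++ˡ : ∀ (xs ys : List A) → Distinct (xs ++ ys) → Distinct xs
  distinct-++ˡ [] ys d = tt
  distinct-++ˡ (x ∷ xs) ys (x∉ , d) = x∉ ∘ ∈-++⁺ˡ , distinct-++ˡ xs ys d

  distinct-++ʳ : ∀ (xs ys : List A) → Distinct (xs ++ ys) → Distinct ys
  distinct-++ʳ [] ys d = d
  distinct-++ʳ (x ∷ xs) ys (_ , d) = distinct-++ʳ xs ys d

  distinct-++-disjoint : ∀ (xs ys : List A) → Distinct (xs ++ ys) → ∀ {x} → x ∈ xs → x ∉ ys
  distinct-++-disjoint (x ∷ xs) ys (x∉ , d) (here refl) = x∉ ∘ ∈-++⁺ʳ xs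
  distinct-++-disjoint (x ∷ xs) ys (_ , d) (there x∈xs) = distinct-++-disjoint xs ys d x∈xs

  distinct-++ : ∀ (xs ys : List A) → Distinct xs → Distinct ys → (∀ {x} → x ∈ xs → x ∉ ys) → Distinct (xs ++ ys)
  distinct-++ [] ys _ dys _ = dys
  distinct-++ (x ∷ xs) ys (x∉xs , dxs) dys disj =
    [ x∉xs , disj (here refl) ]′ ∘ ∈-++⁻ xs , distinct-++ xs ys dxs dys (disj ∘ there)

  distinct-resp-↭ : ∀ {xs ys : List A} → xs ↭ ys → Distinct xs → Distinct ys
  distinct-resp-↭ ↭.refl d = d
  distinct-resp-↭ (↭.prep x p) (x∉ , d) = x∉ ∘ ∈-resp-↭ (↭-sym p) , distinct-resp-↭ p d
  distinct-resp-↭ (↭.swap x y p) (x∉ , y∉ , d) =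
    (λ { (here y≡x) → x∉ (here (sym y≡x)) ; (there y∈) → y∉ (∈-resp-↭ (↭-sym p) y∈) }) ,
    x∉ ∘ there ∘ ∈-resp-↭ (↭-sym p) , distinct-resp-↭ p d
  distinct-resp-↭ (↭.trans p q) d = distinct-resp-↭ q (distinct-resp-↭ p d)

unique⇒distinct : ∀ {A : Set} {xs : List A} → Unique xs → Distinct xs
unique⇒distinct [] = tt
unique⇒distinct (x≢ ∷ u) = Allₚ.All¬⇒¬Any x≢ , unique⇒distinct u

distinct⇒lookup-injective : ∀ {A : Set} (xs : List A) → Distinct xs → Injective _≡_ _≡_ (List.lookup xs)
distinct⇒lookup-injective (x ∷ xs) d {zero} {zero} _ = refl
distinct⇒lookup-injective (x ∷ xs) (x∉ , d) {zero} {suc j} x≡ = absurd (x∉ (subst (_∈ xs) (sym x≡) (∈-lookup j)))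
distinct⇒lookup-injective (x ∷ xs) (x∉ , d) {suc i} {zero} ≡x = absurd (x∉ (subst (_∈ xs) ≡x (∈-lookup i)))
distinct⇒lookup-injective (x ∷ xs) (x∉ , d) {suc i} {suc j} eq = cong suc (distinct⇒lookup-injective xs d eq)

distinct-length≤ : ∀ {n} (xs : List (Fin n)) → Distinct xs → length xs ≤ n
distinct-length≤ {n} xs d with length xs ≤? n
... | yes ≤n = ≤n
... | no ≰n with pigeonhole (≰⇒> ≰n) (List.lookup xs)
...   | i , j , i<j , same = absurd (<-irreflᶠ (distinct⇒lookup-injective xs d same) i<j)

∣[]≔true∣≤ : ∀ {m} (X : Subset m) v → ∣ X [ v ]≔ true ∣ ≤ suc ∣ X ∣
∣[]≔true∣≤ (true ∷ X) zero = n≤1+n _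
∣[]≔true∣≤ (false ∷ X) zero = ≤-refl
∣[]≔true∣≤ (true ∷ X) (suc v) = s≤s (∣[]≔true∣≤ X v)
∣[]≔true∣≤ (false ∷ X) (suc v) = ∣[]≔true∣≤ X v

∅-pebble : ∀ {m} (r : Fin m) → ∅ [ r ]≔ true ≡ ⁅ r ⁆
∅-pebble zero = refl
∅-pebble (suc r) = cong (false ∷_) (∅-pebble r)

module Configurations {n : ℕ} (E : Digraph n) (noLoop : ∀ v → ¬ Arc E v v) where

  toggle : Subset n → Fin n → Subset n
  toggle X v = X [ v ]≔ not (lookup X v)

  pebble : Subset n → Fin n → Subset n
  pebble X v = X [ v ]≔ true

  Ready : Subset n → Fin n → Set
  Ready X v = ∀ u → Arc E u v → lookup X u ≡ true

  play : Subset n → List (Fin n) → Subset n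
  play X [] = X
  play X (v ∷ s) = play (toggle X v) s

  Legal : ℕ → Subset n → List (Fin n) → Set
  Legal K X [] = ∣ X ∣ ≤ K
  Legal K X (v ∷ s) = ∣ X ∣ ≤ K × Ready X v × Legal K (toggle X v) s

  pebbleAll : Subset n → List (Fin n) → Subset n
  pebbleAll X [] = X
  pebbleAll X (v ∷ L) = pebbleAll (pebble X v) L

  play-++ : ∀ X s t → play X (s ++ t) ≡ play (play X s) t
  play-++ X [] t = refl
  play-++ X (v ∷ s) t = play-++ (toggle X v) s t

  pebbleAll-++ : ∀ X s t → pebbleAll X (s ++ t) ≡ pebbleAll (pebbleAll X s) t
  pebbleAll-++ X [] t = refl
  pebbleAll-++ X (v ∷ s) t = pebbleAll-++ (pebble X v) s t

  legal-++ : ∀ {K} X s t → Legal K X s → Legal K (play X s) t → Legal K X (s ++ t)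
  legal-++ X [] t g h = h
  legal-++ X (v ∷ s) t (a , b , g) h = a , b , legal-++ (toggle X v) s t g h

  legal-mono : ∀ {K K′} → K ≤ K′ → ∀ X s → Legal K X s → Legal K′ X s
  legal-mono K≤K′ X [] g = ≤-trans g K≤K′
  legal-mono K≤K′ X (v ∷ s) (a , b , g) = ≤-trans a K≤K′ , b , legal-mono K≤K′ _ s g

  legal-initial : ∀ {K} X s → Legal K X s → ∣ X ∣ ≤ K
  legal-initial X [] g = g
  legal-initial X (v ∷ s) (a , _ , _) = a

  Run : ℕ → Subset n → List (Fin n) → Subset n → Set
  Run K X s Y = Legal K X s × play X s ≡ Y

  run-++ : ∀ {K X Y Z s t} → Run K X s Y → Run K Y t Z → Run K X (s ++ t) Z
  run-++ {X = X} {s = s} {t} (g , refl) (h , refl) = legal-++ X s t g h , play-++ X s t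

  run-mono : ∀ {K K′ X Y} s → K ≤ K′ → Run K X s Y → Run K′ X s Y
  run-mono s K≤K′ (g , e) = legal-mono K≤K′ _ s g , e

  toggle-involutive : ∀ X v → toggle (toggle X v) v ≡ X
  toggle-involutive X v = begin
      (X [ v ]≔ b) [ v ]≔ not (lookup (X [ v ]≔ b) v)  ≡⟨ cong (λ z → (X [ v ]≔ b) [ v ]≔ not z) (lookup∘update v X b) ⟩
      (X [ v ]≔ b) [ v ]≔ not b                        ≡⟨ []≔-idempotent X v ⟩
      X [ v ]≔ not b                                   ≡⟨ cong (X [ v ]≔_) (not-involutive (lookup X v)) ⟩
      X [ v ]≔ lookup X v                              ≡⟨ []≔-lookup X v ⟩
      X                                                ∎
    where open ≡-Reasoning
          b = not (lookup X v)

  ready-toggle : ∀ X v → Ready X v → Ready (toggle X v) v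
  ready-toggle X v ready u u→v =
    trans (lookup∘update′ (λ u≡v → noLoop v (subst (λ z → Arc E z v) u≡v u→v)) X _) (ready u u→v)

  run-reverse : ∀ {K X Y} s → Run K X s Y → Run K Y (reverse s) X
  run-reverse [] (g , refl) = g , refl
  run-reverse {K} {X} (v ∷ s) ((a , b , g) , refl) =
    subst (λ z → Run K (play (toggle X v) s) z X) (sym (reverse-++ [ v ] s))
      (run-++ (run-reverse s (g , refl)) undoFirst)
    where
      undoFirst : Run K (toggle X v) [ v ] X
      undoFirst = (legal-initial _ s g , ready-toggle X v b ,
                   subst (λ Z → ∣ Z ∣ ≤ K) (sym (toggle-involutive X v)) a) ,
                  toggle-involutive X v

  lookup-pebble : ∀ X v → lookup (pebble X v) v ≡ true
  lookup-pebble X v = lookup∘update v X true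

  lookup-pebble-≢ : ∀ X v x → x ≢ v → lookup (pebble X v) x ≡ lookup X x
  lookup-pebble-≢ X v x x≢v = lookup∘update′ x≢v X true

  pebble-preserves : ∀ X v x → lookup X x ≡ true → lookup (pebble X v) x ≡ true
  pebble-preserves X v x Xx with x ≟ v
  ... | yes refl = lookup-pebble X v
  ... | no x≢v = trans (lookup-pebble-≢ X v x x≢v) Xx

  pebbleAll-preserves : ∀ X L x → lookup X x ≡ true → lookup (pebbleAll X L) x ≡ true
  pebbleAll-preserves X [] x Xx = Xx
  pebbleAll-preserves X (v ∷ L) x Xx = pebbleAll-preserves (pebble X v) L x (pebble-preserves X v x Xx)

  lookup-pebbleAll-∈ : ∀ X L x → x ∈ L → lookup (pebbleAll X L) x ≡ true
  lookup-pebbleAll-∈ X (v ∷ L) x (here refl) = pebbleAll-preserves (pebble X v) L x (lookup-pebble X v)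
  lookup-pebbleAll-∈ X (v ∷ L) x (there x∈L) = lookup-pebbleAll-∈ (pebble X v) L x x∈L

  lookup-pebbleAll-∉ : ∀ X L x → x ∉ L → lookup (pebbleAll X L) x ≡ lookup X x
  lookup-pebbleAll-∉ X [] x x∉L = refl
  lookup-pebbleAll-∉ X (v ∷ L) x x∉L =
    trans (lookup-pebbleAll-∉ (pebble X v) L x (x∉L ∘ there)) (lookup-pebble-≢ X v x (x∉L ∘ here))

  ∣pebble∣≤ : ∀ X v → ∣ pebble X v ∣ ≤ suc ∣ X ∣
  ∣pebble∣≤ = ∣[]≔true∣≤

  ∣pebbleAll∣≤ : ∀ X L → ∣ pebbleAll X L ∣ ≤ ∣ X ∣ + length L
  ∣pebbleAll∣≤ X [] = ≤-reflexive (sym (+-identityʳ _))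
  ∣pebbleAll∣≤ X (v ∷ L) = begin
    ∣ pebbleAll (pebble X v) L ∣  ≤⟨ ∣pebbleAll∣≤ (pebble X v) L ⟩
    ∣ pebble X v ∣ + length L     ≤⟨ +-monoˡ-≤ (length L) (∣pebble∣≤ X v) ⟩
    suc ∣ X ∣ + length L          ≡⟨ sym (+-suc ∣ X ∣ (length L)) ⟩
    ∣ X ∣ + length (v ∷ L)        ∎
    where open ≤-Reasoning

  pebble-comm : ∀ X a b → pebble (pebble X a) b ≡ pebble (pebble X b) a
  pebble-comm X a b with a ≟ b
  ... | yes refl = refl
  ... | no a≢b = []≔-commutes X a b a≢b

  pebbleAll-pebble : ∀ X v L → pebbleAll (pebble X v) L ≡ pebble (pebbleAll X L) v
  pebbleAll-pebble X v [] = refl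
  pebbleAll-pebble X v (w ∷ L) =
    trans (cong (λ Y → pebbleAll Y L) (pebble-comm X v w)) (pebbleAll-pebble (pebble X w) v L)

  toggle-unpebbled : ∀ X v → lookup X v ≡ false → toggle X v ≡ pebble X v
  toggle-unpebbled X v Xv = cong (X [ v ]≔_) (cong not Xv)

  pebble-move : ∀ {K} X v → Ready X v → lookup X v ≡ false → suc ∣ X ∣ ≤ K → Run K X [ v ] (pebble X v)
  pebble-move {K} X v ready Xv bound =
    (≤-trans (n≤1+n _) bound , ready ,
     subst (λ Z → ∣ Z ∣ ≤ K) (sym (toggle-unpebbled X v Xv)) (≤-trans (∣pebble∣≤ X v) bound)) ,
    toggle-unpebbled X v Xv

  configurations : Subset n → (s : List (Fin n)) → Fin (suc (length s)) → Subset n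
  configurations X s zero = X
  configurations X (v ∷ s) (suc j) = configurations (toggle X v) s j

  run⇒pebbling : ∀ {K Y} X s → Run K X s Y →
    configurations X s zero ≡ X × configurations X s (fromℕ (length s)) ≡ Y ×
    (∀ j → Move E (configurations X s (inject₁ j)) (configurations X s (suc j))) ×
    (∀ j → ∣ configurations X s j ∣ ≤ K)
  run⇒pebbling X [] (g , refl) = refl , refl , (λ ()) , λ { zero → g }
  run⇒pebbling X (v ∷ s) ((g , ready , legal) , refl) with run⇒pebbling (toggle X v) s (legal , refl)
  ... | _ , last , moves , bounded =
    refl , last ,
    (λ { zero → v , refl , (λ u u→v → lookup⇒[]= u X (ready u u→v)) ; (suc j) → moves j }) ,
    λ { zero → g ; (suc j) → bounded j }

pebbleFactor : ℕ → ℕ → ℕ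
pebbleFactor D zero = 2 * D
pebbleFactor D (suc i) = suc (2 * D + pebbleFactor D i)

pebbleFactor-suc : ∀ {D B l i} → 1 ≤ B → l ≤ 2 * D * B → suc (l + pebbleFactor D i * B) ≤ pebbleFactor D (suc i) * B
pebbleFactor-suc {D} {B} {l} {i} 1≤B l≤ = begin
  suc (l + pebbleFactor D i * B)          ≤⟨ s≤s (+-monoˡ-≤ _ l≤) ⟩
  suc (2 * D * B + pebbleFactor D i * B)  ≤⟨ +-monoˡ-≤ _ 1≤B ⟩
  B + (2 * D * B + pebbleFactor D i * B)  ≡⟨ cong (B +_) (sym (*-distribʳ-+ B (2 * D) (pebbleFactor D i))) ⟩
  pebbleFactor D (suc i) * B              ∎
  where open ≤-Reasoning

suc-*≤2* : ∀ {D m} → 1 ≤ D → 1 ≤ m → suc (D * m) ≤ 2 * D * m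
suc-*≤2* {D} {m} 1≤D 1≤m = ≤-trans (+-monoˡ-≤ (D * m) (*-mono-≤ 1≤D 1≤m))
  (≤-reflexive (solve 2 (λ d m → d :* m :+ d :* m := (con 2 :* d) :* m) refl D m))

module Trees {n : ℕ} (E : Digraph n) (noLoop : ∀ v → ¬ Arc E v v) where
  open Configurations E noLoop

  -- leaves `input v` stand for vertices that are pebbled throughout
  data Tree : Set where
    input : Fin n → Tree
    node  : Fin n → List Tree → Tree

  root : Tree → Fin n
  root (input v) = v
  root (node v _) = v

  roots : List Tree → List (Fin n)
  roots = map root

  nodes  : Tree → List (Fin n)
  nodes⋆ : List Tree → List (Fin n)
  nodes (input _) = []
  nodes (node v ts) = nodes⋆ ts ++ [ v ]
  nodes⋆ [] = []
  nodes⋆ (t ∷ ts) = nodes t ++ nodes⋆ ts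

  inputs  : Tree → List (Fin n)
  inputs⋆ : List Tree → List (Fin n)
  inputs (input v) = [ v ]
  inputs (node v ts) = inputs⋆ ts
  inputs⋆ [] = []
  inputs⋆ (t ∷ ts) = inputs t ++ inputs⋆ ts

  size : Tree → ℕ
  size t = length (nodes t)

  size-node : ∀ v ts → size (node v ts) ≡ suc (length (nodes⋆ ts))
  size-node v ts = trans (length-++ (nodes⋆ ts)) (+-comm _ 1)

  Closed  : Tree → Set
  Closed⋆ : List Tree → Set
  Closed (input _) = ⊤
  Closed (node v ts) = (∀ u → Arc E u v → u ∈ roots ts) × Closed⋆ ts
  Closed⋆ [] = ⊤
  Closed⋆ (t ∷ ts) = Closed t × Closed⋆ ts

  ∈-roots : ∀ ts {x} → x ∈ roots ts → x ∈ inputs⋆ ts ⊎ x ∈ nodes⋆ ts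
  ∈-roots (input v ∷ ts) (here refl) = inj₁ (here refl)
  ∈-roots (node v us ∷ ts) (here refl) = inj₂ (∈-++⁺ˡ (∈-++⁺ʳ (nodes⋆ us) (here refl)))
  ∈-roots (t ∷ ts) (there x∈) with ∈-roots ts x∈
  ... | inj₁ p = inj₁ (∈-++⁺ʳ (inputs t) p)
  ... | inj₂ p = inj₂ (∈-++⁺ʳ (nodes t) p)

  Pebbled : Subset n → List (Fin n) → Set
  Pebbled X L = ∀ {x} → x ∈ L → lookup X x ≡ true

  Unpebbled : Subset n → List (Fin n) → Set
  Unpebbled X L = ∀ {x} → x ∈ L → lookup X x ≡ false

  ready-after-children : ∀ X v ts → (∀ u → Arc E u v → u ∈ roots ts) → Pebbled X (inputs⋆ ts) →
                         Ready (pebbleAll X (nodes⋆ ts)) v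
  ready-after-children X v ts closed pebbled u u→v with ∈-roots ts (closed u u→v)
  ... | inj₁ p = pebbleAll-preserves X (nodes⋆ ts) u (pebbled p)
  ... | inj₂ p = lookup-pebbleAll-∈ X (nodes⋆ ts) u p

  node-bound : ∀ {K} (X : Subset n) v ts → ∣ X ∣ + size (node v ts) ≤ K → suc (∣ X ∣ + length (nodes⋆ ts)) ≤ K
  node-bound {K} X v ts = subst (_≤ K) (trans (cong (∣ X ∣ +_) (size-node v ts)) (+-suc _ _))

  root∉children : ∀ v ts → Distinct (nodes (node v ts)) → v ∉ nodes⋆ ts
  root∉children v ts d v∈ = distinct-++-disjoint (nodes⋆ ts) [ v ] d v∈ (here refl)

  pebbleNodes  : ∀ {K} t X → Closed t → Distinct (nodes t) → Pebbled X (inputs t) → Unpebbled X (nodes t) →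
                 ∣ X ∣ + size t ≤ K → Run K X (nodes t) (pebbleAll X (nodes t))
  pebbleNodes⋆ : ∀ {K} ts X → Closed⋆ ts → Distinct (nodes⋆ ts) → Pebbled X (inputs⋆ ts) → Unpebbled X (nodes⋆ ts) →
                 ∣ X ∣ + length (nodes⋆ ts) ≤ K → Run K X (nodes⋆ ts) (pebbleAll X (nodes⋆ ts))
  pebbleNodes (input x) X _ _ _ _ bound = ≤-trans (m≤m+n _ _) bound , refl
  pebbleNodes {K} (node v ts) X (closed , closed⋆) d pebbled unpebbled bound =
    subst (Run K X (s ++ [ v ])) (sym (pebbleAll-++ X s [ v ]))
      (run-++ (pebbleNodes⋆ ts X closed⋆ (distinct-++ˡ s [ v ] d) pebbled (unpebbled ∘ ∈-++⁺ˡ)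
                             (≤-trans (n≤1+n _) bound′))
              (pebble-move Y v (ready-after-children X v ts closed pebbled) Yv
                             (≤-trans (s≤s (∣pebbleAll∣≤ X s)) bound′)))
    where
      s = nodes⋆ ts
      Y = pebbleAll X s
      bound′ = node-bound X v ts bound
      Yv : lookup Y v ≡ false
      Yv = trans (lookup-pebbleAll-∉ X s v (root∉children v ts d)) (unpebbled (∈-++⁺ʳ s (here refl)))
  pebbleNodes⋆ [] X _ _ _ _ bound = ≤-trans (m≤m+n _ _) bound , refl
  pebbleNodes⋆ {K} (t ∷ ts) X (closed , closed⋆) d pebbled unpebbled bound =
    subst (Run K X (nodes t ++ nodes⋆ ts)) (sym (pebbleAll-++ X (nodes t) (nodes⋆ ts)))
      (run-++ (pebbleNodes t X closed (distinct-++ˡ (nodes t) _ d) (pebbled ∘ ∈-++⁺ˡ) (unpebbled ∘ ∈-++⁺ˡ)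
                           (≤-trans (+-monoʳ-≤ ∣ X ∣ (m≤m+n _ _)) bound″))
              (pebbleNodes⋆ ts Y closed⋆ (distinct-++ʳ (nodes t) _ d)
                            (λ {x} x∈ → pebbleAll-preserves X (nodes t) x (pebbled (∈-++⁺ʳ (inputs t) x∈)))
                            (λ {x} x∈ → trans (lookup-pebbleAll-∉ X (nodes t) x
                                                 (λ x∈t → distinct-++-disjoint (nodes t) _ d x∈t x∈))
                                              (unpebbled (∈-++⁺ʳ (nodes t) x∈)))
                            (≤-trans (+-monoˡ-≤ _ (∣pebbleAll∣≤ X (nodes t)))
                                     (≤-trans (≤-reflexive (+-assoc ∣ X ∣ _ _)) bound″))))
    where
      Y = pebbleAll X (nodes t)
      bound″ : ∣ X ∣ + (length (nodes t) + length (nodes⋆ ts)) ≤ K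
      bound″ = subst (λ z → ∣ X ∣ + z ≤ K) (length-++ (nodes t)) bound

  PebblesRoot : List (Fin n) → ℕ → Tree → Set
  PebblesRoot s K t = ∀ X → Pebbled X (inputs t) → Unpebbled X (nodes t) → Run (∣ X ∣ + K) X s (pebble X (root t))

  pebblesRoot-mono : ∀ {s K K′} t → K ≤ K′ → PebblesRoot s K t → PebblesRoot s K′ t
  pebblesRoot-mono {s} t K≤K′ p X pebbled unpebbled = run-mono s (+-monoʳ-≤ ∣ X ∣ K≤K′) (p X pebbled unpebbled)

  naive : Tree → List (Fin n)
  naive (input v) = []
  naive (node v ts) = nodes⋆ ts ++ v ∷ reverse (nodes⋆ ts)

  naive-pebblesRoot : ∀ v ts → Closed (node v ts) → Distinct (nodes (node v ts)) →
                      PebblesRoot (naive (node v ts)) (size (node v ts)) (node v ts)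
  naive-pebblesRoot v ts (closed , closed⋆) d X pebbled unpebbled =
    run-++ (pebbleNodes⋆ ts X closed⋆ ds pebbled (unpebbled ∘ ∈-++⁺ˡ) (≤-trans (n≤1+n _) bound))
      (run-++ (subst (Run K Y [ v ]) (sym (pebbleAll-pebble X v s))
                (pebble-move Y v (ready-after-children X v ts closed pebbled) Yv
                  (≤-trans (s≤s (∣pebbleAll∣≤ X s)) bound)))
              (run-reverse s (pebbleNodes⋆ ts X′ closed⋆ ds (λ {x} → pebble-preserves X v x ∘ pebbled)
                (λ {x} x∈ → trans (lookup-pebble-≢ X v x (λ { refl → v∉s x∈ })) (unpebbled (∈-++⁺ˡ x∈)))
                (≤-trans (+-monoˡ-≤ _ (∣pebble∣≤ X v)) bound))))
    where
      s = nodes⋆ ts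
      K = ∣ X ∣ + size (node v ts)
      Y = pebbleAll X s
      X′ = pebble X v
      ds = distinct-++ˡ s [ v ] d
      v∉s = root∉children v ts d
      bound = node-bound X v ts ≤-refl
      Yv : lookup Y v ≡ false
      Yv = trans (lookup-pebbleAll-∉ X s v v∉s) (unpebbled (∈-++⁺ʳ s (here refl)))

  Branching≤ : ℕ → Tree → Set
  Branching≤⋆ : ℕ → List Tree → Set
  Branching≤ D (input _) = ⊤
  Branching≤ D (node v ts) = length ts ≤ D × Branching≤⋆ D ts
  Branching≤⋆ D [] = ⊤
  Branching≤⋆ D (t ∷ ts) = Branching≤ D t × Branching≤⋆ D ts

  WellFormed : ℕ → Tree → Set
  WellFormed D t = Closed t × Branching≤ D t

  Ordered : List (Fin n) → List Tree → Set
  Ordered A [] = ⊤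
  Ordered A (t ∷ ts) = inputs t ⊆ A × Ordered (root t ∷ A) ts

  ordered-mono : ∀ {A A′} ts → A ⊆ A′ → Ordered A ts → Ordered A′ ts
  ordered-mono [] A⊆A′ o = tt
  ordered-mono (t ∷ ts) A⊆A′ (inputs⊆ , o) =
    A⊆A′ ∘ inputs⊆ , ordered-mono ts (λ { (here refl) → here refl ; (there x∈) → there (A⊆A′ x∈) }) o

  ordered-++ : ∀ {A} A′ ts us → Ordered A ts → A′ ⊆ roots ts ++ A → Ordered A′ us → Ordered A (ts ++ us)
  ordered-++ A′ [] us o A′⊆ o′ = ordered-mono us A′⊆ o′
  ordered-++ {A} A′ (t ∷ ts) us (inputs⊆ , o) A′⊆ o′ = inputs⊆ , ordered-++ A′ ts us o (shift ∘ A′⊆) o′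
    where
      shift : roots (t ∷ ts) ++ A ⊆ roots ts ++ root t ∷ A
      shift (here refl) = ∈-++⁺ʳ (roots ts) (here refl)
      shift (there x∈) = [ ∈-++⁺ˡ , ∈-++⁺ʳ (roots ts) ∘ there ]′ (∈-++⁻ (roots ts) x∈)

  nodes⋆-++ : ∀ ts us → nodes⋆ (ts ++ us) ≡ nodes⋆ ts ++ nodes⋆ us
  nodes⋆-++ [] us = refl
  nodes⋆-++ (t ∷ ts) us = trans (cong (nodes t ++_) (nodes⋆-++ ts us)) (sym (++-assoc (nodes t) _ _))

  roots-mono : ∀ {ts us : List Tree} → (∀ {t} → t ∈ ts → t ∈ us) → roots ts ⊆ roots us
  roots-mono ts⊆us x∈ with ∈-map⁻ root x∈
  ... | t , t∈ , refl = ∈-map⁺ root (ts⊆us t∈)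

  Piece : ℕ → ℕ → Tree → Set
  Piece D m t = m ≤ size t × size t ≤ suc (D * m)

  -- Bottom-up, every subtree that keeps at least m nodes after cutting its own subtrees is split
  -- off as a piece and replaced by an input leaf for its root.
  module Cut (D m : ℕ) where
    cutStep : List Tree × Tree → List Tree × List Tree → Fin n → List Tree × List Tree
    cutStep (ps , r) (qs , rs) v with m ≤? size r
    ... | yes _ = ps ++ r ∷ qs , input v ∷ rs
    ... | no _ = ps ++ qs , r ∷ rs

    cut  : Tree → List Tree × Tree
    cut⋆ : List Tree → List Tree × List Tree
    cut (input v) = [] , input v
    cut (node v ts) = proj₁ (cut⋆ ts) , node v (proj₂ (cut⋆ ts))
    cut⋆ [] = [] , []
    cut⋆ (t ∷ ts) = cutStep (cut t) (cut⋆ ts) (root t)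

    pieces : Tree → List Tree
    pieces t = proj₁ (cut t)

    remainder : Tree → Tree
    remainder t = proj₂ (cut t)

    cutStep-roots : ∀ ps r qs rs t ts → root r ≡ root t → roots rs ≡ roots ts →
                    roots (proj₂ (cutStep (ps , r) (qs , rs) (root t))) ≡ roots (t ∷ ts)
    cutStep-roots ps r qs rs t ts p q with m ≤? size r
    ... | yes _ = cong (root t ∷_) q
    ... | no _ = cong₂ _∷_ p q

    cut-root  : ∀ t → root (remainder t) ≡ root t
    cut⋆-roots : ∀ ts → roots (proj₂ (cut⋆ ts)) ≡ roots ts
    cut-root (input v) = refl
    cut-root (node v ts) = refl
    cut⋆-roots [] = refl
    cut⋆-roots (t ∷ ts) =
      cutStep-roots (pieces t) (remainder t) (proj₁ (cut⋆ ts)) (proj₂ (cut⋆ ts)) t ts (cut-root t) (cut⋆-roots ts)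

    cutStep-perm : ∀ ps r qs rs t ts → nodes⋆ ps ++ nodes r ↭ nodes t → nodes⋆ qs ++ nodes⋆ rs ↭ nodes⋆ ts →
      nodes⋆ (proj₁ (cutStep (ps , r) (qs , rs) (root t))) ++ nodes⋆ (proj₂ (cutStep (ps , r) (qs , rs) (root t)))
        ↭ nodes⋆ (t ∷ ts)
    cutStep-perm ps r qs rs t ts p q with m ≤? size r
    ... | yes _ = ↭-trans (↭-reflexive regroup) (++⁺ p q)
      where
        open ≡-Reasoning
        regroup : nodes⋆ (ps ++ r ∷ qs) ++ nodes⋆ rs ≡ (nodes⋆ ps ++ nodes r) ++ (nodes⋆ qs ++ nodes⋆ rs)
        regroup = begin
          nodes⋆ (ps ++ r ∷ qs) ++ nodes⋆ rs                 ≡⟨ cong (_++ nodes⋆ rs) (nodes⋆-++ ps (r ∷ qs)) ⟩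
          (nodes⋆ ps ++ (nodes r ++ nodes⋆ qs)) ++ nodes⋆ rs ≡⟨ ++-assoc (nodes⋆ ps) _ _ ⟩
          nodes⋆ ps ++ ((nodes r ++ nodes⋆ qs) ++ nodes⋆ rs) ≡⟨ cong (nodes⋆ ps ++_) (++-assoc (nodes r) _ _) ⟩
          nodes⋆ ps ++ (nodes r ++ (nodes⋆ qs ++ nodes⋆ rs)) ≡⟨ sym (++-assoc (nodes⋆ ps) _ _) ⟩
          (nodes⋆ ps ++ nodes r) ++ (nodes⋆ qs ++ nodes⋆ rs) ∎
    ... | no _ = ↭-trans (↭-reflexive regroup)
                   (↭-trans (++⁺ˡ (nodes⋆ ps) (shifts (nodes⋆ qs) (nodes r)))
                     (↭-trans (↭-reflexive (sym (++-assoc (nodes⋆ ps) (nodes r) _))) (++⁺ p q)))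
      where
        regroup : nodes⋆ (ps ++ qs) ++ (nodes r ++ nodes⋆ rs) ≡ nodes⋆ ps ++ (nodes⋆ qs ++ (nodes r ++ nodes⋆ rs))
        regroup = trans (cong (_++ _) (nodes⋆-++ ps qs)) (++-assoc (nodes⋆ ps) _ _)

    cut-perm  : ∀ t → nodes⋆ (pieces t) ++ nodes (remainder t) ↭ nodes t
    cut⋆-perm : ∀ ts → nodes⋆ (proj₁ (cut⋆ ts)) ++ nodes⋆ (proj₂ (cut⋆ ts)) ↭ nodes⋆ ts
    cut-perm (input v) = ↭-refl
    cut-perm (node v ts) =
      ↭-trans (↭-reflexive (sym (++-assoc (nodes⋆ (proj₁ (cut⋆ ts))) _ [ v ]))) (++⁺ʳ [ v ] (cut⋆-perm ts))
    cut⋆-perm [] = ↭-refl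
    cut⋆-perm (t ∷ ts) =
      cutStep-perm (pieces t) (remainder t) (proj₁ (cut⋆ ts)) (proj₂ (cut⋆ ts)) t ts (cut-perm t) (cut⋆-perm ts)

    cutStep-ordered : ∀ ps r qs rs t ts → root r ≡ root t →
      Ordered (inputs t) ps → inputs r ⊆ inputs t ++ roots ps →
      Ordered (inputs⋆ ts) qs → inputs⋆ rs ⊆ inputs⋆ ts ++ roots qs →
      Ordered (inputs⋆ (t ∷ ts)) (proj₁ (cutStep (ps , r) (qs , rs) (root t))) ×
      inputs⋆ (proj₂ (cutStep (ps , r) (qs , rs) (root t))) ⊆
        inputs⋆ (t ∷ ts) ++ roots (proj₁ (cutStep (ps , r) (qs , rs) (root t)))
    cutStep-ordered ps r qs rs t ts r≡t ops r⊆ oqs rs⊆ with m ≤? size r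
    ... | yes _ =
      ordered-++ (roots ps ++ A) ps (r ∷ qs) (ordered-mono ps ∈-++⁺ˡ ops) id
        (r⊆′ , ordered-mono qs (there ∘ ∈-++⁺ʳ (roots ps) ∘ ∈-++⁺ʳ (inputs t)) oqs) ,
      rest
      where
        A = inputs t ++ inputs⋆ ts
        r⊆′ : inputs r ⊆ roots ps ++ A
        r⊆′ x∈ = [ ∈-++⁺ʳ (roots ps) ∘ ∈-++⁺ˡ , ∈-++⁺ˡ ]′ (∈-++⁻ (inputs t) (r⊆ x∈))
        rest : root t ∷ inputs⋆ rs ⊆ A ++ roots (ps ++ r ∷ qs)
        rest (here refl) = ∈-++⁺ʳ A (subst (_∈ roots (ps ++ r ∷ qs)) r≡t (∈-map⁺ root (∈-++⁺ʳ ps (here refl))))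
        rest (there x∈) = [ ∈-++⁺ˡ ∘ ∈-++⁺ʳ (inputs t) , ∈-++⁺ʳ A ∘ roots-mono (∈-++⁺ʳ ps ∘ there) ]′
                            (∈-++⁻ (inputs⋆ ts) (rs⊆ x∈))
    ... | no _ =
      ordered-++ (roots ps ++ A) ps qs (ordered-mono ps ∈-++⁺ˡ ops) id
        (ordered-mono qs (∈-++⁺ʳ (roots ps) ∘ ∈-++⁺ʳ (inputs t)) oqs) ,
      rest
      where
        A = inputs t ++ inputs⋆ ts
        rest : inputs r ++ inputs⋆ rs ⊆ A ++ roots (ps ++ qs)
        rest x∈ with ∈-++⁻ (inputs r) x∈
        ... | inj₁ x∈r = [ ∈-++⁺ˡ ∘ ∈-++⁺ˡ , ∈-++⁺ʳ A ∘ roots-mono ∈-++⁺ˡ ]′ (∈-++⁻ (inputs t) (r⊆ x∈r))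
        ... | inj₂ x∈rs = [ ∈-++⁺ˡ ∘ ∈-++⁺ʳ (inputs t) , ∈-++⁺ʳ A ∘ roots-mono (∈-++⁺ʳ ps) ]′
                            (∈-++⁻ (inputs⋆ ts) (rs⊆ x∈rs))

    cut-ordered  : ∀ t → Ordered (inputs t) (pieces t) × inputs (remainder t) ⊆ inputs t ++ roots (pieces t)
    cut⋆-ordered : ∀ ts → Ordered (inputs⋆ ts) (proj₁ (cut⋆ ts)) ×
                          inputs⋆ (proj₂ (cut⋆ ts)) ⊆ inputs⋆ ts ++ roots (proj₁ (cut⋆ ts))
    cut-ordered (input v) = tt , ∈-++⁺ˡ
    cut-ordered (node v ts) = cut⋆-ordered ts
    cut⋆-ordered [] = tt , λ ()
    cut⋆-ordered (t ∷ ts) =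
      cutStep-ordered (pieces t) (remainder t) (proj₁ (cut⋆ ts)) (proj₂ (cut⋆ ts)) t ts (cut-root t)
        (proj₁ (cut-ordered t)) (proj₂ (cut-ordered t)) (proj₁ (cut⋆-ordered ts)) (proj₂ (cut⋆-ordered ts))

    cutStep-size : ∀ ps r qs rs t ts → All (Piece D m) ps → size r ≤ suc (D * m) →
      All (Piece D m) qs → length (nodes⋆ rs) ≤ length ts * m →
      All (Piece D m) (proj₁ (cutStep (ps , r) (qs , rs) (root t))) ×
      length (nodes⋆ (proj₂ (cutStep (ps , r) (qs , rs) (root t)))) ≤ length (t ∷ ts) * m
    cutStep-size ps r qs rs t ts aps r≤ aqs rs≤ with m ≤? size r
    ... | yes m≤r = Allₚ.++⁺ aps ((m≤r , r≤) ∷ aqs) , ≤-trans rs≤ (m≤n+m _ m)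
    ... | no m≰r = Allₚ.++⁺ aps aqs ,
                   subst (_≤ m + length ts * m) (sym (length-++ (nodes r))) (+-mono-≤ (<⇒≤ (≰⇒> m≰r)) rs≤)

    cut-size  : ∀ t → Branching≤ D t → All (Piece D m) (pieces t) × size (remainder t) ≤ suc (D * m)
    cut⋆-size : ∀ ts → Branching≤⋆ D ts → All (Piece D m) (proj₁ (cut⋆ ts)) ×
                                          length (nodes⋆ (proj₂ (cut⋆ ts))) ≤ length ts * m
    cut-size (input v) _ = [] , z≤n
    cut-size (node v ts) (ts≤D , b) with cut⋆-size ts b
    ... | a , rest≤ = a , subst (_≤ suc (D * m)) (sym (size-node v (proj₂ (cut⋆ ts))))
                             (s≤s (≤-trans rest≤ (*-monoˡ-≤ m ts≤D)))
    cut⋆-size [] _ = [] , z≤n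
    cut⋆-size (t ∷ ts) (bt , bts) =
      cutStep-size (pieces t) (remainder t) (proj₁ (cut⋆ ts)) (proj₂ (cut⋆ ts)) t ts
        (proj₁ (cut-size t bt)) (proj₂ (cut-size t bt)) (proj₁ (cut⋆-size ts bts)) (proj₂ (cut⋆-size ts bts))

    cutStep-wellFormed : ∀ ps r qs rs t → All (WellFormed D) ps → WellFormed D r →
      All (WellFormed D) qs → Closed⋆ rs × Branching≤⋆ D rs →
      All (WellFormed D) (proj₁ (cutStep (ps , r) (qs , rs) (root t))) ×
      Closed⋆ (proj₂ (cutStep (ps , r) (qs , rs) (root t))) × Branching≤⋆ D (proj₂ (cutStep (ps , r) (qs , rs) (root t)))
    cutStep-wellFormed ps r qs rs t wps wr wqs (crs , brs) with m ≤? size r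
    ... | yes _ = Allₚ.++⁺ wps (wr ∷ wqs) , (tt , crs) , (tt , brs)
    ... | no _ = Allₚ.++⁺ wps wqs , (proj₁ wr , crs) , (proj₂ wr , brs)

    cut-wellFormed  : ∀ t → WellFormed D t → All (WellFormed D) (pieces t) × WellFormed D (remainder t)
    cut⋆-wellFormed : ∀ ts → Closed⋆ ts → Branching≤⋆ D ts →
      All (WellFormed D) (proj₁ (cut⋆ ts)) × Closed⋆ (proj₂ (cut⋆ ts)) × Branching≤⋆ D (proj₂ (cut⋆ ts))
    cut-wellFormed (input v) w = [] , w
    cut-wellFormed (node v ts) ((closed , closed⋆) , (ts≤D , b)) with cut⋆-wellFormed ts closed⋆ b
    ... | a , crs , brs =
      a , ((λ u u→v → subst (u ∈_) (sym (cut⋆-roots ts)) (closed u u→v)) , crs) ,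
      (subst (_≤ D) (sym sameLength) ts≤D , brs)
      where
        sameLength : length (proj₂ (cut⋆ ts)) ≡ length ts
        sameLength = trans (sym (length-map root (proj₂ (cut⋆ ts))))
                           (trans (cong length (cut⋆-roots ts)) (length-map root ts))
    cut⋆-wellFormed [] _ _ = [] , tt , tt
    cut⋆-wellFormed (t ∷ ts) (ct , cts) (bt , bts) =
      cutStep-wellFormed (pieces t) (remainder t) (proj₁ (cut⋆ ts)) (proj₂ (cut⋆ ts)) t
        (proj₁ (cut-wellFormed t (ct , bt))) (proj₂ (cut-wellFormed t (ct , bt)))
        (proj₁ (cut⋆-wellFormed ts cts bts)) (proj₂ (cut⋆-wellFormed ts cts bts))

  roots-in-nodes : ∀ ps → All (λ p → root p ∈ nodes p) ps → roots ps ⊆ nodes⋆ ps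
  roots-in-nodes (p ∷ ps) (root∈ ∷ _) (here refl) = ∈-++⁺ˡ root∈
  roots-in-nodes (p ∷ ps) (_ ∷ roots∈) (there x∈) = ∈-++⁺ʳ (nodes p) (roots-in-nodes ps roots∈ x∈)

  pebbleRoots : ∀ (S : Tree → List (Fin n)) {K} ps X A →
    All (λ p → PebblesRoot (S p) K p) ps → All (λ p → root p ∈ nodes p) ps → Ordered A ps → Pebbled X A →
    Distinct (nodes⋆ ps) → Unpebbled X (nodes⋆ ps) →
    Run (∣ X ∣ + length ps + K) X (concatMap S ps) (pebbleAll X (roots ps))
  pebbleRoots S {K} [] X A _ _ _ _ _ _ = ≤-trans (m≤m+n ∣ X ∣ 0) (m≤m+n _ K) , refl
  pebbleRoots S {K} (p ∷ ps) X A (pebbles ∷ pebbles⋆) (root∈ ∷ roots∈) (inputs⊆ , ordered) pebbled d unpebbled =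
    run-++ (run-mono (S p) (+-monoˡ-≤ K (m≤m+n ∣ X ∣ _)) (pebbles X (pebbled ∘ inputs⊆) (unpebbled ∘ ∈-++⁺ˡ)))
           (run-mono (concatMap S ps) bound
             (pebbleRoots S ps X′ (root p ∷ A) pebbles⋆ roots∈ ordered pebbled′ (distinct-++ʳ (nodes p) _ d) unpebbled′))
    where
      X′ = pebble X (root p)
      bound : ∣ X′ ∣ + length ps + K ≤ ∣ X ∣ + length (p ∷ ps) + K
      bound = +-monoˡ-≤ K (≤-trans (+-monoˡ-≤ (length ps) (∣pebble∣≤ X (root p)))
                                   (≤-reflexive (sym (+-suc ∣ X ∣ _))))
      pebbled′ : Pebbled X′ (root p ∷ A)
      pebbled′ (here refl) = lookup-pebble X (root p)
      pebbled′ {x} (there x∈) = pebble-preserves X (root p) x (pebbled x∈)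
      unpebbled′ : Unpebbled X′ (nodes⋆ ps)
      unpebbled′ {x} x∈ = trans (lookup-pebble-≢ X (root p) x λ { refl → distinct-++-disjoint (nodes p) _ d root∈ x∈ })
                                (unpebbled (∈-++⁺ʳ (nodes p) x∈))

  combine : (Tree → List (Fin n)) → List Tree → Tree → List (Fin n)
  combine S ps r = concatMap S ps ++ S r ++ reverse (concatMap S ps)

  combine-pebblesRoot : ∀ (S : Tree → List (Fin n)) {K} t ps r →
    All (λ p → PebblesRoot (S p) K p) ps → PebblesRoot (S r) K r →
    All (λ p → root p ∈ nodes p) ps → root r ∈ nodes r → root r ≡ root t →
    Ordered (inputs t) ps → inputs r ⊆ inputs t ++ roots ps →
    nodes⋆ ps ++ nodes r ↭ nodes t → Distinct (nodes t) →
    PebblesRoot (combine S ps r) (suc (length ps + K)) t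
  combine-pebblesRoot S {K} t ps r pebbles⋆ pebbles roots∈ root∈ sameRoot ordered inputs⊆ perm d X pebbled unpebbled =
    run-++ (run-mono A (bound ∣ X ∣ (n≤1+n _)) phase₁)
      (run-++ (run-mono (S r) (≤-trans (+-monoˡ-≤ K ∣XA∣≤) (bound ∣ X ∣ (n≤1+n _))) phase₂)
              (run-reverse A (run-mono A (bound ∣ X′ ∣ (∣pebble∣≤ X v)) phase₃)))
    where
      m = length ps
      v = root t
      A = concatMap S ps
      XA = pebbleAll X (roots ps)
      X′ = pebble X v
      dPieces : Distinct (nodes⋆ ps ++ nodes r)
      dPieces = distinct-resp-↭ (↭-sym perm) d
      inT : ∀ {x} → x ∈ nodes⋆ ps ++ nodes r → x ∈ nodes t
      inT = ∈-resp-↭ perm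
      apart : ∀ {x} → x ∈ nodes⋆ ps → x ∉ nodes r
      apart = distinct-++-disjoint (nodes⋆ ps) (nodes r) dPieces
      roots⊆ : roots ps ⊆ nodes⋆ ps
      roots⊆ = roots-in-nodes ps roots∈
      bound : ∀ c → c ≤ suc ∣ X ∣ → c + m + K ≤ ∣ X ∣ + suc (m + K)
      bound c c≤ = ≤-trans (+-monoˡ-≤ K (+-monoˡ-≤ m c≤))
                           (≤-reflexive (trans (+-assoc (suc ∣ X ∣) m K) (sym (+-suc ∣ X ∣ (m + K)))))
      ∣XA∣≤ : ∣ XA ∣ ≤ ∣ X ∣ + m
      ∣XA∣≤ = ≤-trans (∣pebbleAll∣≤ X (roots ps)) (≤-reflexive (cong (∣ X ∣ +_) (length-map root ps)))
      phase₁ : Run (∣ X ∣ + m + K) X A XA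
      phase₁ = pebbleRoots S ps X (inputs t) pebbles⋆ roots∈ ordered pebbled
                 (distinct-++ˡ (nodes⋆ ps) _ dPieces) (unpebbled ∘ inT ∘ ∈-++⁺ˡ)
      phase₂ : Run (∣ XA ∣ + K) XA (S r) (pebbleAll X′ (roots ps))
      phase₂ = subst (Run (∣ XA ∣ + K) XA (S r))
                 (trans (cong (pebble XA) sameRoot) (sym (pebbleAll-pebble X v (roots ps))))
                 (pebbles XA
                   (λ {x} x∈ → [ pebbleAll-preserves X (roots ps) x ∘ pebbled , lookup-pebbleAll-∈ X (roots ps) x ]′
                                 (∈-++⁻ (inputs t) (inputs⊆ x∈)))
                   (λ {x} x∈ → trans (lookup-pebbleAll-∉ X (roots ps) x (λ x∈roots → apart (roots⊆ x∈roots) x∈))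
                                     (unpebbled (inT (∈-++⁺ʳ (nodes⋆ ps) x∈)))))
      phase₃ : Run (∣ X′ ∣ + m + K) X′ A (pebbleAll X′ (roots ps))
      phase₃ = pebbleRoots S ps X′ (inputs t) pebbles⋆ roots∈ ordered (λ {x} → pebble-preserves X v x ∘ pebbled)
                 (distinct-++ˡ (nodes⋆ ps) _ dPieces)
                 (λ {x} x∈ → trans (lookup-pebble-≢ X v x λ { refl → apart x∈ (subst (_∈ nodes r) sameRoot root∈) })
                                   (unpebbled (inT (∈-++⁺ˡ x∈))))

  root∈nodes : ∀ t → 1 ≤ size t → root t ∈ nodes t
  root∈nodes (node v ts) _ = ∈-++⁺ʳ (nodes⋆ ts) (here refl)

  pieces-count : ∀ {D m} ps → All (Piece D m) ps → length ps * m ≤ length (nodes⋆ ps)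
  pieces-count [] _ = z≤n
  pieces-count {D} {m} (p ∷ ps) ((m≤p , _) ∷ pieces) =
    subst (m + length ps * m ≤_) (sym (length-++ (nodes p))) (+-mono-≤ m≤p (pieces-count {D} ps pieces))

  concatMap-length : ∀ (S : Tree → List (Fin n)) b ps → (∀ p → length (S p) ≤ b * size p) →
                     length (concatMap S ps) ≤ b * length (nodes⋆ ps)
  concatMap-length S b [] _ = z≤n
  concatMap-length S b (p ∷ ps) S≤ = begin
    length (S p ++ concatMap S ps)                  ≡⟨ length-++ (S p) ⟩
    length (S p) + length (concatMap S ps)          ≤⟨ +-mono-≤ (S≤ p) (concatMap-length S b ps S≤) ⟩
    b * size p + b * length (nodes⋆ ps)             ≡⟨ sym (*-distribˡ-+ b (size p) _) ⟩
    b * (size p + length (nodes⋆ ps))               ≡⟨ cong (b *_) (sym (length-++ (nodes p))) ⟩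
    b * length (nodes⋆ (p ∷ ps))                    ∎
    where open ≤-Reasoning

  combine-length : ∀ (S : Tree → List (Fin n)) b t ps r → (∀ p → length (S p) ≤ b * size p) →
                   nodes⋆ ps ++ nodes r ↭ nodes t → length (combine S ps r) ≤ 2 * b * size t
  combine-length S b t ps r S≤ perm = begin
    length (A ++ S r ++ reverse A)                  ≡⟨ length-++ A ⟩
    length A + length (S r ++ reverse A)            ≡⟨ cong (length A +_) (length-++ (S r)) ⟩
    length A + (length (S r) + length (reverse A))  ≡⟨ cong (λ z → length A + (length (S r) + z)) (length-reverse A) ⟩
    length A + (length (S r) + length A)            ≤⟨ +-mono-≤ A≤ (+-mono-≤ (S≤ r) A≤) ⟩
    b * L + (b * size r + b * L)                    ≤⟨ m≤m+n _ (b * size r) ⟩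
    b * L + (b * size r + b * L) + b * size r       ≡⟨ solve 3 (λ b l s → b :* l :+ (b :* s :+ b :* l) :+ b :* s
                                                                 := (con 2 :* b) :* (l :+ s)) refl b L (size r) ⟩
    2 * b * (L + size r)                            ≡⟨ cong (2 * b *_) (trans (sym (length-++ (nodes⋆ ps))) (↭-length perm)) ⟩
    2 * b * size t                                  ∎
    where
      open ≤-Reasoning
      A = concatMap S ps
      L = length (nodes⋆ ps)
      A≤ : length A ≤ b * L
      A≤ = concatMap-length S b ps S≤

  naive-length : ∀ t → length (naive t) ≤ 2 * size t
  naive-length (input v) = z≤n
  naive-length (node v ts) = begin
    length (s ++ v ∷ reverse s)     ≡⟨ length-++ s ⟩
    length s + suc (length (reverse s)) ≡⟨ cong (λ z → length s + suc z) (length-reverse s) ⟩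
    length s + suc (length s)       ≤⟨ +-monoˡ-≤ (suc (length s)) (n≤1+n (length s)) ⟩
    suc (length s) + suc (length s) ≡⟨ cong (suc (length s) +_) (sym (+-identityʳ _)) ⟩
    2 * suc (length s)              ≡⟨ cong (2 *_) (sym (size-node v ts)) ⟩
    2 * size (node v ts)            ∎
    where
      open ≤-Reasoning
      s = nodes⋆ ts

  few-pieces : ∀ {D m c} t ps r → 1 ≤ m → All (Piece D m) ps → nodes⋆ ps ++ nodes r ↭ nodes t →
               size t ≤ c * m → length ps ≤ c
  few-pieces {D} {m} {c} t ps r 1≤m pieces perm t≤ = *-cancelʳ-≤ (length ps) c m {{>-nonZero 1≤m}} (begin
    length ps * m                 ≤⟨ pieces-count {D} ps pieces ⟩
    length (nodes⋆ ps)            ≤⟨ m≤m+n _ (size r) ⟩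
    length (nodes⋆ ps) + size r   ≡⟨ trans (sym (length-++ (nodes⋆ ps))) (↭-length perm) ⟩
    size t                        ≤⟨ t≤ ⟩
    c * m                         ∎)
    where open ≤-Reasoning

  -- Level i + 1 handles trees of at most 2 D B^(i+2) nodes: cutting at threshold B^(i+1) leaves
  -- at most 2 D B pieces, and pieces and remainder have at most 2 D B^(i+1) nodes each.
  module Recursive (D B : ℕ) where
    strategy : ℕ → Tree → List (Fin n)
    strategy zero t = naive t
    strategy (suc i) t = combine (strategy i) (pieces t) (remainder t)
      where open Cut D (B ^ suc i)

    strategy-length : ∀ i t → length (strategy i t) ≤ 2 ^ suc i * size t
    strategy-length zero t = subst (λ z → length (naive t) ≤ z * size t) (sym (*-identityʳ 2)) (naive-length t)
    strategy-length (suc i) t =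
      combine-length (strategy i) (2 ^ suc i) t (pieces t) (remainder t) (strategy-length i) (cut-perm t)
      where open Cut D (B ^ suc i)

    strategy-pebblesRoot : 1 ≤ D → 1 ≤ B → ∀ i t → WellFormed D t → Distinct (nodes t) → 1 ≤ size t →
                           size t ≤ 2 * D * B ^ suc i → PebblesRoot (strategy i t) (pebbleFactor D i * B) t
    strategy-pebblesRoot _ _ zero (node v ts) (closed , _) d _ t≤ =
      pebblesRoot-mono (node v ts) (≤-trans t≤ (≤-reflexive (cong (2 * D *_) (*-identityʳ B))))
        (naive-pebblesRoot v ts closed d)
    strategy-pebblesRoot 1≤D 1≤B (suc i) t@(node v ts) wf d _ t≤ =
      pebblesRoot-mono t (pebbleFactor-suc {D} {i = i} 1≤B (few-pieces {D} t ps r 1≤m (proj₁ sizes) (cut-perm t) t≤′))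
        (combine-pebblesRoot (strategy i) t ps r
          (pieces-pebblesRoot ps (proj₁ wfs) (proj₁ sizes) (distinct-++ˡ (nodes⋆ ps) _ dPieces))
          (strategy-pebblesRoot 1≤D 1≤B i r (proj₂ wfs) (distinct-++ʳ (nodes⋆ ps) _ dPieces)
             (≤-trans (s≤s z≤n) (≤-reflexive (sym (size-node v (proj₂ (cut⋆ ts))))))
             (≤-trans (proj₂ sizes) (suc-*≤2* 1≤D 1≤m)))
          (All.map (λ {p} piece → root∈nodes p (≤-trans 1≤m (proj₁ piece))) (proj₁ sizes))
          (∈-++⁺ʳ (nodes⋆ (proj₂ (cut⋆ ts))) (here refl)) refl
          (proj₁ (cut-ordered t)) (proj₂ (cut-ordered t)) (cut-perm t) d)
      where
        m = B ^ suc i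
        open Cut D m
        ps = pieces t
        r = remainder t
        1≤m : 1 ≤ m
        1≤m = m^n>0 B {{>-nonZero 1≤B}} (suc i)
        t≤′ : size t ≤ 2 * D * B * m
        t≤′ = ≤-trans t≤ (≤-reflexive (sym (*-assoc (2 * D) B m)))
        dPieces = distinct-resp-↭ (↭-sym (cut-perm t)) d
        wfs = cut-wellFormed t wf
        sizes = cut-size t (proj₂ wf)
        pieces-pebblesRoot : ∀ qs → All (WellFormed D) qs → All (Piece D m) qs → Distinct (nodes⋆ qs) →
                             All (λ p → PebblesRoot (strategy i p) (pebbleFactor D i * B) p) qs
        pieces-pebblesRoot [] _ _ _ = []
        pieces-pebblesRoot (q ∷ qs) (wq ∷ wqs) ((m≤q , q≤) ∷ pieces) dq =
          strategy-pebblesRoot 1≤D 1≤B i q wq (distinct-++ˡ (nodes q) _ dq) (≤-trans 1≤m m≤q)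
            (≤-trans q≤ (suc-*≤2* 1≤D 1≤m))
          ∷ pieces-pebblesRoot qs wqs pieces (distinct-++ʳ (nodes q) _ dq)

module Walks {n : ℕ} (E : Digraph n) where
  open import Data.List.Membership.DecPropositional (_≟_ {n}) using (_∈?_)

  Chain : (Fin n → Fin n → Set) → Fin n → List (Fin n) → Set
  Chain R a [] = ⊤
  Chain R a (y ∷ ys) = R a y × Chain R y ys

  endOf : Fin n → List (Fin n) → Fin n
  endOf a [] = a
  endOf a (y ∷ ys) = endOf y ys

  chain-map : ∀ {R R′ : Fin n → Fin n → Set} → (∀ {x y} → R x y → R′ x y) → ∀ a ys → Chain R a ys → Chain R′ a ys
  chain-map f a [] _ = tt
  chain-map f a (y ∷ ys) (r , c) = f r , chain-map f y ys c

  DistinctChain : (Fin n → Fin n → Set) → Fin n → Fin n → Set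
  DistinctChain R a b = ∃[ ys ] (Chain R a ys × Distinct (a ∷ ys) × endOf a ys ≡ b)

  chain-from : ∀ {R a w} zs → a ∈ w ∷ zs → Chain R w zs → Distinct (w ∷ zs) → DistinctChain R a (endOf w zs)
  chain-from zs (here refl) ch d = zs , ch , d , refl
  chain-from (z ∷ zs) (there a∈) (_ , ch) (_ , d) = chain-from zs a∈ ch d

  distinctChain-◅ : ∀ {R a w b} → R a w → DistinctChain R w b → DistinctChain R a b
  distinctChain-◅ {a = a} {w} r (zs , ch , d , end) with a ∈? w ∷ zs
  ... | yes a∈ = let ys , ch′ , d′ , end′ = chain-from zs a∈ ch d in ys , ch′ , d′ , trans end′ end
  ... | no a∉ = w ∷ zs , (r , ch) , (a∉ , d) , end

  walk⇒distinctChain : ∀ {R a b} → Star R a b → DistinctChain R a b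
  walk⇒distinctChain ε = [] , tt , ((λ ()) , tt) , refl
  walk⇒distinctChain (r ◅ wk) = distinctChain-◅ r (walk⇒distinctChain wk)

  chain-lookup : ∀ {R} a ys → Chain R a ys → ∀ (i : Fin (length ys)) →
                 R (List.lookup (a ∷ ys) (inject₁ i)) (List.lookup (a ∷ ys) (suc i))
  chain-lookup a (y ∷ ys) (r , c) zero = r
  chain-lookup a (y ∷ ys) (r , c) (suc i) = chain-lookup y ys c i

  lookup-last : ∀ a ys → List.lookup (a ∷ ys) (fromℕ (length ys)) ≡ endOf a ys
  lookup-last a [] = refl
  lookup-last a (y ∷ ys) = lookup-last y ys

  distinctChain⇒cycle : ∀ a b c zs → Chain (Adj E) a (b ∷ c ∷ zs) → Distinct (a ∷ b ∷ c ∷ zs) →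
                        Adj E (endOf a (b ∷ c ∷ zs)) a → Cycle E
  distinctChain⇒cycle a b c zs ch d closing =
    length zs , List.lookup (a ∷ b ∷ c ∷ zs) ,
    distinct⇒lookup-injective (a ∷ b ∷ c ∷ zs) d , chain-lookup a (b ∷ c ∷ zs) ch ,
    subst (λ z → Adj E z a) (sym (lookup-last a (b ∷ c ∷ zs))) closing

  dreach⇒walk : ∀ {a b} → DReach E a b → Star (Arc E) a b
  dreach⇒walk here = ε
  dreach⇒walk (step a→w w⇝b) = a→w ◅ dreach⇒walk w⇝b

module RootedTreeFacts {n : ℕ} (E : Digraph n) (r : Fin n) (tree : RootedTree E r) where
  open Walks E

  noLoop : ∀ v → ¬ Arc E v v
  noLoop = proj₁ (proj₁ tree)

  noAntiparallel : ∀ u v → Arc E u v → ¬ Arc E v u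
  noAntiparallel = proj₁ (proj₂ (proj₁ tree))

  noCycle : ¬ Cycle E
  noCycle = proj₁ (proj₂ (proj₂ (proj₁ tree)))

  no-directed-cycle : ∀ {u w} → Arc E u w → ¬ DReach E w u
  no-directed-cycle {u} {w} u→w w⇝u with walk⇒distinctChain (dreach⇒walk w⇝u)
  ... | [] , _ , _ , end = noLoop u (subst (Arc E u) end u→w)
  ... | y ∷ [] , (w→y , _) , _ , end = noAntiparallel u w u→w (subst (Arc E w) end w→y)
  ... | y ∷ z ∷ zs , ch , d , end =
    noCycle (distinctChain⇒cycle w y z zs (chain-map inj₁ w (y ∷ z ∷ zs) ch) d
               (subst (λ x → Adj E x w) (sym end) (inj₁ u→w)))

  Avoiding : Fin n → Fin n → Fin n → Set
  Avoiding v x y = Adj E x y × x ≢ v × y ≢ v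

  avoiding-sym : ∀ {v x y} → Avoiding v x y → Avoiding v y x
  avoiding-sym (inj₁ a , x≢v , y≢v) = inj₂ a , y≢v , x≢v
  avoiding-sym (inj₂ a , x≢v , y≢v) = inj₁ a , y≢v , x≢v

  avoiding-walk : ∀ v {a b} → (∀ {y} → DReach E a y → y ≢ v) → DReach E a b → Star (Avoiding v) a b
  avoiding-walk v avoids here = ε
  avoiding-walk v avoids (step a→w w⇝b) =
    (inj₁ a→w , avoids here , avoids (step a→w here)) ◅ avoiding-walk v (avoids ∘ step a→w) w⇝b

  downstream-avoids : ∀ {v w y} → Arc E v w → DReach E w y → y ≢ v
  downstream-avoids v→w w⇝y refl = no-directed-cycle v→w w⇝y

  avoiding-chain-∉ : ∀ v a ys → Chain (Avoiding v) a ys → a ≢ v → v ∉ a ∷ ys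
  avoiding-chain-∉ v a ys ch a≢v (here refl) = a≢v refl
  avoiding-chain-∉ v a (y ∷ ys) ((_ , _ , y≢v) , ch) a≢v (there v∈) = avoiding-chain-∉ v y ys ch y≢v v∈

  -- Two out-arcs v → w₁, v → w₂ with w₁ ≢ w₂ would close a cycle with the undirected path
  -- w₁ ⇝ r ⇝ w₂, which avoids v since v is not reachable from its out-neighbours.
  out-arc-unique : ∀ {v w₁ w₂} → Arc E v w₁ → Arc E v w₂ → w₁ ≡ w₂
  out-arc-unique {v} {w₁} {w₂} v→w₁ v→w₂ with w₁ ≟ w₂
  ... | yes same = same
  ... | no w₁≢w₂ = absurd (closes (walk⇒distinctChain throughRoot))
    where
      throughRoot : Star (Avoiding v) w₁ w₂
      throughRoot = avoiding-walk v (downstream-avoids v→w₁) (proj₂ tree w₁) ◅◅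
                    Star.reverse avoiding-sym (avoiding-walk v (downstream-avoids v→w₂) (proj₂ tree w₂))
      closes : ¬ DistinctChain (Avoiding v) w₁ w₂
      closes ([] , _ , _ , end) = w₁≢w₂ end
      closes (y ∷ zs , ch , d , end) =
        noCycle (distinctChain⇒cycle v w₁ y zs (inj₁ v→w₁ , chain-map proj₁ w₁ (y ∷ zs) ch)
                   (avoiding-chain-∉ v w₁ (y ∷ zs) ch (downstream-avoids v→w₁ here) , d)
                   (subst (λ z → Adj E z v) (sym end) (inj₂ v→w₂)))

  reach-comparable : ∀ {x a b} → DReach E x a → DReach E x b → DReach E a b ⊎ DReach E b a
  reach-comparable here x⇝b = inj₁ x⇝b
  reach-comparable (step x→y y⇝a) here = inj₂ (step x→y y⇝a)
  reach-comparable (step x→y y⇝a) (step x→y′ y′⇝b) with out-arc-unique x→y x→y′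
  ... | refl = reach-comparable y⇝a y′⇝b

  siblings-disjoint : ∀ {x u u′ v} → u ≢ u′ → DReach E x u → DReach E x u′ → Arc E u v → Arc E u′ v → ⊥
  siblings-disjoint u≢u′ x⇝u x⇝u′ u→v u′→v with reach-comparable x⇝u x⇝u′
  ... | inj₁ here = u≢u′ refl
  ... | inj₁ (step u→y y⇝u′) with out-arc-unique u→y u→v
  ...   | refl = no-directed-cycle u′→v y⇝u′
  siblings-disjoint u≢u′ x⇝u x⇝u′ u→v u′→v | inj₂ here = u≢u′ refl
  siblings-disjoint u≢u′ x⇝u x⇝u′ u→v u′→v | inj₂ (step u′→y y⇝u) with out-arc-unique u′→y u′→v
  ...   | refl = no-directed-cycle u→v y⇝u

module Unfolding {n : ℕ} (E : Digraph n) (r : Fin n) (tree : RootedTree E r) where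
  open Walks E
  open RootedTreeFacts E r tree
  open Trees E noLoop

  arcsInto : Fin n → List (Fin n) → List (Fin n)
  arcsInto v [] = []
  arcsInto v (u ∷ us) = if E u v then u ∷ arcsInto v us else arcsInto v us

  ∈-arcsInto⁺ : ∀ {u v} xs → u ∈ xs → Arc E u v → u ∈ arcsInto v xs
  ∈-arcsInto⁺ {u} {v} (x ∷ xs) u∈ u→v with E x v in eq
  ∈-arcsInto⁺ (x ∷ xs) (here refl) u→v | true = here refl
  ∈-arcsInto⁺ (x ∷ xs) (there u∈) u→v | true = there (∈-arcsInto⁺ xs u∈ u→v)
  ∈-arcsInto⁺ (x ∷ xs) (here refl) u→v | false = absurd (subst T eq u→v)
  ∈-arcsInto⁺ (x ∷ xs) (there u∈) u→v | false = ∈-arcsInto⁺ xs u∈ u→v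

  ∈-arcsInto⁻ : ∀ {u v} xs → u ∈ arcsInto v xs → u ∈ xs × Arc E u v
  ∈-arcsInto⁻ {u} {v} (x ∷ xs) u∈ with E x v in eq
  ∈-arcsInto⁻ (x ∷ xs) (here refl) | true = here refl , subst T (sym eq) tt
  ∈-arcsInto⁻ (x ∷ xs) (there u∈) | true = map₁ there (∈-arcsInto⁻ xs u∈)
  ∈-arcsInto⁻ (x ∷ xs) u∈ | false = map₁ there (∈-arcsInto⁻ xs u∈)

  arcsInto-distinct : ∀ v xs → Distinct xs → Distinct (arcsInto v xs)
  arcsInto-distinct v [] d = tt
  arcsInto-distinct v (x ∷ xs) (x∉ , d) with E x v
  ... | true = x∉ ∘ proj₁ ∘ ∈-arcsInto⁻ xs , arcsInto-distinct v xs d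
  ... | false = arcsInto-distinct v xs d

  arcsInto-length : ∀ v xs → length (arcsInto v xs) ≤ sum (map (λ u → if E u v ∨ E v u then 1 else 0) xs)
  arcsInto-length v [] = z≤n
  arcsInto-length v (x ∷ xs) with E x v
  ... | true = s≤s (arcsInto-length v xs)
  ... | false = ≤-trans (arcsInto-length v xs) (m≤n+m _ _)

  inNeighbours : Fin n → List (Fin n)
  inNeighbours v = arcsInto v (allFin n)

  unfold : ℕ → Fin n → Tree
  unfold zero v = node v []
  unfold (suc f) v = node v (map (unfold f) (inNeighbours v))

  roots-unfold : ∀ f xs → roots (map (unfold f) xs) ≡ xs
  roots-unfold f [] = refl
  roots-unfold zero (x ∷ xs) = cong (x ∷_) (roots-unfold zero xs)
  roots-unfold (suc f) (x ∷ xs) = cong (x ∷_) (roots-unfold (suc f) xs)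

  inputs-unfold  : ∀ f v → inputs (unfold f v) ≡ []
  inputs⋆-unfold : ∀ f xs → inputs⋆ (map (unfold f) xs) ≡ []
  inputs-unfold zero v = refl
  inputs-unfold (suc f) v = inputs⋆-unfold f (inNeighbours v)
  inputs⋆-unfold f [] = refl
  inputs⋆-unfold f (x ∷ xs) = cong₂ _++_ (inputs-unfold f x) (inputs⋆-unfold f xs)

  ∈-nodes⋆-unfold : ∀ f xs {x} → x ∈ nodes⋆ (map (unfold f) xs) → ∃[ u ] (u ∈ xs × x ∈ nodes (unfold f u))
  ∈-nodes⋆-unfold f (u ∷ xs) x∈ with ∈-++⁻ (nodes (unfold f u)) x∈
  ... | inj₁ x∈u = u , here refl , x∈u
  ... | inj₂ x∈xs = let w , w∈ , x∈w = ∈-nodes⋆-unfold f xs x∈xs in w , there w∈ , x∈w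

  dreach-snoc : ∀ {x u v} → DReach E x u → Arc E u v → DReach E x v
  dreach-snoc here u→v = step u→v here
  dreach-snoc (step x→y y⇝u) u→v = step x→y (dreach-snoc y⇝u u→v)

  unfold-reaches : ∀ f v {x} → x ∈ nodes (unfold f v) → DReach E x v
  unfold-reaches zero v (here refl) = here
  unfold-reaches (suc f) v x∈ with ∈-++⁻ (nodes⋆ (map (unfold f) (inNeighbours v))) x∈
  ... | inj₂ (here refl) = here
  ... | inj₁ x∈⋆ = let u , u∈ , x∈u = ∈-nodes⋆-unfold f (inNeighbours v) x∈⋆
                   in dreach-snoc (unfold-reaches f u x∈u) (proj₂ (∈-arcsInto⁻ (allFin n) u∈))

  -- Distinct since out-arcs are unique, so distinct in-neighbours of v have disjoint sets of ancestors.
  unfold-distinct  : ∀ f v → Distinct (nodes (unfold f v))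
  unfold⋆-distinct : ∀ f v us → Distinct us → (∀ {u} → u ∈ us → Arc E u v) → Distinct (nodes⋆ (map (unfold f) us))
  unfold-distinct zero v = (λ ()) , tt
  unfold-distinct (suc f) v =
    distinct-++ (nodes⋆ children) [ v ]
      (unfold⋆-distinct f v (inNeighbours v) (arcsInto-distinct v (allFin n) (unique⇒distinct (allFin⁺ n)))
                        (proj₂ ∘ ∈-arcsInto⁻ (allFin n)))
      ((λ ()) , tt) v∉
    where
      children = map (unfold f) (inNeighbours v)
      v∉ : ∀ {x} → x ∈ nodes⋆ children → x ∉ [ v ]
      v∉ x∈ (here refl) = let u , u∈ , x∈u = ∈-nodes⋆-unfold f (inNeighbours v) x∈
                          in no-directed-cycle (proj₂ (∈-arcsInto⁻ (allFin n) u∈)) (unfold-reaches f u x∈u)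
  unfold⋆-distinct f v [] _ _ = tt
  unfold⋆-distinct f v (u ∷ us) (u∉ , d) arcs =
    distinct-++ (nodes (unfold f u)) _ (unfold-distinct f u) (unfold⋆-distinct f v us d (arcs ∘ there)) apart
    where
      apart : ∀ {x} → x ∈ nodes (unfold f u) → x ∉ nodes⋆ (map (unfold f) us)
      apart x∈u x∈us =
        let u′ , u′∈ , x∈u′ = ∈-nodes⋆-unfold f us x∈us
        in siblings-disjoint (λ { refl → u∉ u′∈ }) (unfold-reaches f u x∈u) (unfold-reaches f u′ x∈u′)
                             (arcs (here refl)) (arcs (there u′∈))

  Depth≤ : ℕ → Fin n → Set
  Depth≤ f v = ∀ a ys → Chain (Arc E) a ys → endOf a ys ≡ v → length ys ≤ f

  chain-snoc : ∀ {R : Fin n → Fin n → Set} {v} a ys → Chain R a ys → R (endOf a ys) v → Chain R a (ys ++ [ v ])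
  chain-snoc a [] _ last = last , tt
  chain-snoc a (y ∷ ys) (r , ch) last = r , chain-snoc y ys ch last

  endOf-snoc : ∀ {v} a ys → endOf a (ys ++ [ v ]) ≡ v
  endOf-snoc a [] = refl
  endOf-snoc a (y ∷ ys) = endOf-snoc y ys

  depth≤-child : ∀ {f u v} → Depth≤ (suc f) v → Arc E u v → Depth≤ f u
  depth≤-child {f} {u} {v} depth u→v a ys ch end =
    ≤-pred (subst (_≤ suc f) (trans (length-++ ys) (+-comm _ 1))
      (depth a (ys ++ [ v ]) (chain-snoc a ys ch (subst (λ z → Arc E z v) (sym end) u→v)) (endOf-snoc a ys)))

  chain-reaches : ∀ {x} a ys → x ∈ a ∷ ys → Chain (Arc E) a ys → DReach E a x
  chain-reaches a ys (here refl) _ = here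
  chain-reaches a (y ∷ ys) (there x∈) (a→y , ch) = step a→y (chain-reaches y ys x∈ ch)

  chain-distinct : ∀ a ys → Chain (Arc E) a ys → Distinct (a ∷ ys)
  chain-distinct a [] _ = (λ ()) , tt
  chain-distinct a (y ∷ ys) (a→y , ch) =
    (λ a∈ → no-directed-cycle a→y (chain-reaches y ys a∈ ch)) , chain-distinct y ys ch

  depth≤n : ∀ v → Depth≤ n v
  depth≤n v a ys ch _ = ≤-trans (n≤1+n _) (distinct-length≤ (a ∷ ys) (chain-distinct a ys ch))

  unfold-closed  : ∀ f v → Depth≤ f v → Closed (unfold f v)
  unfold⋆-closed : ∀ f v us → (∀ {u} → u ∈ us → Arc E u v) → Depth≤ (suc f) v → Closed⋆ (map (unfold f) us)
  unfold-closed zero v depth = (λ u u→v → absurd (1+n≰n (depth u [ v ] (u→v , tt) refl))) , tt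
  unfold-closed (suc f) v depth =
    (λ u u→v → subst (u ∈_) (sym (roots-unfold f (inNeighbours v))) (∈-arcsInto⁺ (allFin n) (∈-allFin u) u→v)) ,
    unfold⋆-closed f v (inNeighbours v) (proj₂ ∘ ∈-arcsInto⁻ (allFin n)) depth
  unfold⋆-closed f v [] _ _ = tt
  unfold⋆-closed f v (u ∷ us) arcs depth =
    unfold-closed f u (depth≤-child depth (arcs (here refl))) , unfold⋆-closed f v us (arcs ∘ there) depth

  unfold-branching  : ∀ {Δ} → (∀ v → degree E v ≤ Δ) → ∀ f v → Branching≤ (suc Δ) (unfold f v)
  unfold⋆-branching : ∀ {Δ} → (∀ v → degree E v ≤ Δ) → ∀ f us → Branching≤⋆ (suc Δ) (map (unfold f) us)
  unfold-branching deg zero v = z≤n , tt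
  unfold-branching deg (suc f) v =
    ≤-trans (≤-reflexive (length-map (unfold f) (inNeighbours v)))
            (≤-trans (arcsInto-length v (allFin n)) (≤-trans (deg v) (n≤1+n _))) ,
    unfold⋆-branching deg f (inNeighbours v)
  unfold⋆-branching deg f [] = tt
  unfold⋆-branching deg f (u ∷ us) = unfold-branching deg f u , unfold⋆-branching deg f us

  root-unfold : ∀ f v → root (unfold f v) ≡ v
  root-unfold zero v = refl
  root-unfold (suc f) v = refl

  unfold-nonempty : ∀ f v → 1 ≤ size (unfold f v)
  unfold-nonempty zero v = s≤s z≤n
  unfold-nonempty (suc f) v = subst (1 ≤_) (sym (size-node v (map (unfold f) (inNeighbours v)))) (s≤s z≤n)

  open Configurations E noLoop

  -- branching Δ + 1 rather than Δ, since the levels need D ≥ 1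
  rootedTree-run : ∀ {Δ} → (∀ v → degree E v ≤ Δ) → ∀ i B → 1 ≤ B → n ≤ 2 * suc Δ * B ^ suc i →
                   ∃[ s ] Run (pebbleFactor (suc Δ) i * B) ∅ s ⁅ r ⁆ × length s ≤ 2 ^ suc i * n
  rootedTree-run {Δ} deg i B 1≤B n≤ =
    strategy i t ,
    subst₂ (λ c Y → Run (c + pebbleFactor (suc Δ) i * B) ∅ (strategy i t) Y)
      (∣⊥∣≡0 n) (trans (cong (pebble ∅) (root-unfold n r)) (∅-pebble r))
      (strategy-pebblesRoot (s≤s z≤n) 1≤B i t
        (unfold-closed n r (depth≤n r) , unfold-branching deg n r) (unfold-distinct n r)
        (unfold-nonempty n r) (≤-trans size≤n n≤)
        ∅ (subst (Pebbled ∅) (sym (inputs-unfold n r)) λ ()) (λ {x} _ → lookup-replicate x false)) ,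
    ≤-trans (strategy-length i t) (*-monoʳ-≤ (2 ^ suc i) size≤n)
    where
      open Recursive (suc Δ) B
      t = unfold n r
      size≤n : size t ≤ n
      size≤n = distinct-length≤ (nodes t) (unfold-distinct n r)

*-^-distrib : ∀ a b k → (a * b) ^ k ≡ a ^ k * b ^ k
*-^-distrib a b zero = refl
*-^-distrib a b (suc k) = trans (cong (a * b *_) (*-^-distrib a b k))
  (solve 4 (λ a b x y → (a :* b) :* (x :* y) := (a :* x) :* (b :* y)) refl a b (a ^ k) (b ^ k))

^-bound : ∀ k {x a b c N} → x ≤ a * b → b ^ k ≤ c * N → x ^ k ≤ a ^ k * c * N
^-bound k {x} {a} {b} {c} {N} x≤ab b^k≤ = begin
  x ^ k              ≤⟨ ^-monoˡ-≤ k x≤ab ⟩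
  (a * b) ^ k        ≡⟨ *-^-distrib a b k ⟩
  a ^ k * b ^ k      ≤⟨ *-monoʳ-≤ (a ^ k) b^k≤ ⟩
  a ^ k * (c * N)    ≡⟨ sym (*-assoc (a ^ k) c N) ⟩
  a ^ k * c * N      ∎
  where open ≤-Reasoning

ceilRoot : ∀ j M → ∃[ B ] pred B ^ suc j ≤ M × suc M ≤ B ^ suc j
ceilRoot j zero = 1 , z≤n , ≤-reflexive (sym (^-zeroˡ (suc j)))
ceilRoot j (suc M) with ceilRoot j M
... | B , below , above with suc (suc M) ≤? B ^ suc j
...   | yes above′ = B , ≤-trans below (n≤1+n M) , above′
...   | no ¬above′ = suc B , ≤-reflexive exact , subst (_< suc B ^ suc j) exact (^-monoˡ-< (suc j) (n<1+n B))
  where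
    exact : B ^ suc j ≡ suc M
    exact = ≤-antisym (≤-pred (≰⇒> ¬above′)) above

ceilRoot-bound : ∀ j M B → pred B ^ suc j ≤ M → suc M ≤ B ^ suc j → 1 ≤ B × B ^ suc j ≤ 2 ^ suc j * suc M
ceilRoot-bound j M zero _ ()
ceilRoot-bound j M 1 _ _ = s≤s z≤n , ≤-trans (≤-reflexive (^-zeroˡ (suc j))) (≤-trans (m^n>0 2 (suc j)) (m≤m*n _ _))
ceilRoot-bound j M (suc (suc d)) below _ = s≤s z≤n , (begin
  suc (suc d) ^ suc j          ≤⟨ ^-monoˡ-≤ (suc j) (≤-trans (m≤m+n (suc (suc d)) d)
                                    (≤-reflexive (solve 1 (λ d → con 2 :+ d :+ d := con 2 :* (con 1 :+ d)) refl d))) ⟩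
  (2 * suc d) ^ suc j          ≡⟨ *-^-distrib 2 (suc d) (suc j) ⟩
  2 ^ suc j * suc d ^ suc j    ≤⟨ *-monoʳ-≤ (2 ^ suc j) (≤-trans below (n≤1+n M)) ⟩
  2 ^ suc j * suc M            ∎)
  where open ≤-Reasoning

mainTheorem10 : (k : ℕ) → 1 ≤ k → (Δ : ℕ) →
    ∃[ C₁ ] ∃[ C₂ ] (∀ (n : ℕ) (E : Digraph n) (r : Fin n) →
      RootedTree E r → (∀ v → degree E v ≤ Δ) →
      ∃[ m ] Σ (Fin (suc m) → Subset n) λ P →
        IsPebbling E r m P
        × (∀ i → ∣ P i ∣ ^ k ≤ C₁ * n)
        × m ≤ C₂ * n)
mainTheorem10 (suc j) _ Δ = a ^ k * 2 ^ k , 2 ^ k , pebbling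
  where
    k = suc j
    a = pebbleFactor (suc Δ) j
    pebbling : ∀ n (E : Digraph n) (r : Fin n) → RootedTree E r → (∀ v → degree E v ≤ Δ) →
      ∃[ m ] Σ (Fin (suc m) → Subset n) λ P →
        IsPebbling E r m P × (∀ i → ∣ P i ∣ ^ k ≤ a ^ k * 2 ^ k * n) × m ≤ 2 ^ k * n
    pebbling (suc M) E r tree deg =
      let B , below , above = ceilRoot j M
          1≤B , B^k≤ = ceilRoot-bound j M B below above
          s , run , moves = rootedTree-run deg j B 1≤B (≤-trans above (m≤n*m _ (2 * suc Δ)))
          start , end , legal , bounded = run⇒pebbling ∅ s run
      in length s , configurations ∅ s , (start , end , legal) ,
         (λ i → ^-bound k {a = a} {B} {2 ^ k} {suc M} (bounded i) B^k≤) , moves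
      where
        open Unfolding E r tree using (rootedTree-run)
        open Configurations E (RootedTreeFacts.noLoop E r tree) using (configurations; run⇒pebbling)
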